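{- Let $n$ be an even integer, let $s$ be a positive integer with $s < n/2$, set $k = s$, and let $x$ be an integer with $2s \le x \le n-s-1$. Let $d$ be the sequence of length $n$ $$d = (\underbrace{n-1, \ldots, n-1}_{s \text{ times}},\, \underbrace{x, \ldots, x}_{n-2s \text{ times}},\, \underbrace{s, \ldots, s}_{s \text{ times}}).$$ Then $d$ is a $k$-factorable graphic sequence, and $d$ has no connected $k$-factor, i.e. there is no graph with degree sequence $d$ containing a connected $k$-regular spanning subgraph.
   Context: A finite nonincreasing sequence of positive integers $d=(d_1,\ldots,d_n)$ is graphic if there is a simple graph on vertices $v_1,\ldots,v_n$ with $\deg(v_i)=d_i$ for all $i$; such a graph is a realization of $d$. A graphic sequence $d$ is $k$-factorable if some realization of $d$ contains a $k$-factor, i.e. a $k$-regular spanning subgraph. A $k$-factor is connected if it is a connected graph. "$d$ has no connected $k$-factor" means no realization of $d$ contains a connected $k$-factor. -}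

module Defs where

open import Data.Nat using (ℕ; zero; suc; _+_; _*_; _∸_; _<_; _≤_; _<ᵇ_)
open import Data.Bool using (Bool; true; false; if_then_else_)
open import Data.Fin using (Fin; toℕ)
open import Data.List using (List; []; _∷_; filter; length)
open import Data.List.Base using (allFin)
open import Data.Product using (Σ; _×_; ∃; ∃-syntax; _,_)
open import Relation.Binary.PropositionalEquality using (_≡_)
open import Relation.Nullary using (¬_)
open import Data.Bool.Properties using (T?)

record Graph (n : ℕ) : Set where
  field
    adj   : Fin n → Fin n → Bool
    sym   : ∀ u v → adj u v ≡ adj v u
    irrefl : ∀ v → adj v v ≡ false
open Graph public

deg : ∀ {n} → Graph n → Fin n → ℕ
deg G v = length (filter (λ u → T? (adj G v u)) (allFin _))

Realizes : ∀ {n} → Graph n → (Fin n → ℕ) → Set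
Realizes G d = ∀ i → deg G i ≡ d i

Graphic : ∀ {n} → (Fin n → ℕ) → Set
Graphic {n} d = Σ (Graph n) λ G → Realizes G d

_⊆G_ : ∀ {n} → Graph n → Graph n → Set
H ⊆G G = ∀ u v → adj H u v ≡ true → adj G u v ≡ true

Regular : ∀ {n} → ℕ → Graph n → Set
Regular k H = ∀ v → deg H v ≡ k

IsFactor : ∀ {n} → ℕ → Graph n → Graph n → Set
IsFactor k H G = H ⊆G G × Regular k H

data Walk {n : ℕ} (G : Graph n) : Fin n → Fin n → Set where
  here : ∀ {u} → Walk G u u
  step : ∀ {u w v} → adj G u w ≡ true → Walk G w v → Walk G u v

Connected : ∀ {n} → Graph n → Set
Connected G = ∀ u v → Walk G u v

KFactorable : ∀ {n} → ℕ → (Fin n → ℕ) → Set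
KFactorable {n} k d = Σ (Graph n) λ G → Realizes G d × Σ (Graph n) λ H → IsFactor k H G

NoConnectedKFactor : ∀ {n} → ℕ → (Fin n → ℕ) → Set
NoConnectedKFactor {n} k d =
  (G : Graph n) → Realizes G d → (H : Graph n) → IsFactor k H G → ¬ Connected H

seqD : (n s x : ℕ) → Fin n → ℕ
seqD n s x i =
  if toℕ i <ᵇ s then n ∸ 1
  else if toℕ i <ᵇ n ∸ s then x
  else s

{-# OPTIONS --safe #-}
module Submission where

-- In any realization the s vertices of degree n - 1 (block A) are adjacent to everything, so
-- each of the s vertices of degree s (block C) is adjacent exactly to A. An s-factor must then
-- contain every A-C edge, which already saturates A and C: A ∪ C is closed in the factor, and
-- the n - 2s middle vertices (block B) are cut off from it.
-- Conversely, write n = 2s + m with m = 2a + 2 and x = s + r with s ≤ r ≤ m - 1. Join A to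
-- everything, C only to A, and put on B the first r colour classes of the round-robin
-- 1-factorisation of K_m. Its first s colour classes together with all A-C edges form an
-- s-factor.

open import Defs hiding (sym)
open import Data.Bool using (Bool; true; false; not; if_then_else_)
open import Data.Bool.Properties using (T?; T-≡)
open import Data.Fin as Fin using (Fin; toℕ; fromℕ<)
open import Data.Fin.Properties using (toℕ-injective; toℕ<n; toℕ-fromℕ<)
open import Data.List using (filter; length; tabulate)
open import Data.Nat
  using (ℕ; zero; suc; _+_; _*_; _∸_; _<_; _≤_; _<ᵇ_; _≡ᵇ_; z≤n; s≤s; z<s; s<s; s≤s⁻¹; NonZero)
open import Data.Nat.DivMod using (_%_; [m+n]%n≡m%n; m<n⇒m%n≡m)
open import Data.Nat.Divisibility using (_∣_; divides)
open import Data.Nat.Properties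
open import Data.Nat.Tactic.RingSolver using (solve-∀)
open import Data.Product using (Σ; _×_; _,_; uncurry)
open import Data.Sum using (_⊎_; inj₁; inj₂)
open import Function using (_∘_; id; Equivalence)
open import Relation.Binary.PropositionalEquality
open import Relation.Nullary using (¬_; yes; no; contradiction)

<ᵇ-true : ∀ {m n} → m < n → (m <ᵇ n) ≡ true
<ᵇ-true m<n = Equivalence.to T-≡ (<⇒<ᵇ m<n)

<ᵇ-true⁻¹ : ∀ {m n} → (m <ᵇ n) ≡ true → m < n
<ᵇ-true⁻¹ {m} {n} eq = <ᵇ⇒< m n (Equivalence.from T-≡ eq)

<ᵇ-false : ∀ {m n} → n ≤ m → (m <ᵇ n) ≡ false
<ᵇ-false {m} {n} n≤m with m <ᵇ n in eq
... | false = refl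
... | true  = contradiction (<ᵇ-true⁻¹ eq) (≤⇒≯ n≤m)

not-<ᵇ-true⁻¹ : ∀ {m n} → not (m <ᵇ n) ≡ true → n ≤ m
not-<ᵇ-true⁻¹ {m} {n} eq with m <ᵇ n in m<ᵇn
... | false = ≮⇒≥ (λ m<n → contradiction (trans (sym m<ᵇn) (<ᵇ-true m<n)) λ ())

≡ᵇ-true⁻¹ : ∀ {m n} → (m ≡ᵇ n) ≡ true → m ≡ n
≡ᵇ-true⁻¹ {m} {n} eq = ≡ᵇ⇒≡ m n (Equivalence.from T-≡ eq)

≡ᵇ-false : ∀ {m n} → m ≢ n → (m ≡ᵇ n) ≡ false
≡ᵇ-false {m} {n} m≢n with m ≡ᵇ n in eq
... | false = refl
... | true  = contradiction (≡ᵇ-true⁻¹ eq) m≢n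

≡ᵇ-refl : ∀ m → (m ≡ᵇ m) ≡ true
≡ᵇ-refl m = Equivalence.to T-≡ (≡⇒≡ᵇ m m refl)

seqD-head : ∀ {n} s x (i : Fin n) → toℕ i < s → seqD n s x i ≡ n ∸ 1
seqD-head s x i i<s rewrite <ᵇ-true i<s = refl

seqD-middle : ∀ {n} s x (i : Fin n) → s ≤ toℕ i → toℕ i < n ∸ s → seqD n s x i ≡ x
seqD-middle s x i s≤i i<n∸s rewrite <ᵇ-false s≤i | <ᵇ-true i<n∸s = refl

seqD-tail : ∀ {n} s x (i : Fin n) → s ≤ n ∸ s → n ∸ s ≤ toℕ i → seqD n s x i ≡ s
seqD-tail s x i s≤n∸s n∸s≤i rewrite <ᵇ-false (≤-trans s≤n∸s n∸s≤i) | <ᵇ-false n∸s≤i = refl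

-- Counting Boolean predicates

indicator : Bool → ℕ
indicator true  = 1
indicator false = 0

_⊆ᵇ_ : {V : Set} → (V → Bool) → (V → Bool) → Set
f ⊆ᵇ g = ∀ x → f x ≡ true → g x ≡ true

count : (ℕ → Bool) → ℕ → ℕ
count f zero    = 0
count f (suc l) = indicator (f 0) + count (f ∘ suc) l

countFin : ∀ {n} → (Fin n → Bool) → ℕ
countFin {zero}  f = 0
countFin {suc n} f = indicator (f Fin.zero) + countFin (f ∘ Fin.suc)

length-filter-tabulate : ∀ {V : Set} n (g : Fin n → V) (p : V → Bool) →
  length (filter (T? ∘ p) (tabulate g)) ≡ countFin (p ∘ g)
length-filter-tabulate zero    g p = refl
length-filter-tabulate (suc n) g p with p (g Fin.zero)
... | true  = cong suc (length-filter-tabulate n (g ∘ Fin.suc) p)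
... | false = length-filter-tabulate n (g ∘ Fin.suc) p

deg≡countFin : ∀ {n} (G : Graph n) v → deg G v ≡ countFin (adj G v)
deg≡countFin {n} G v = length-filter-tabulate n id (adj G v)

countFin-toℕ : ∀ n (f : ℕ → Bool) → countFin (f ∘ toℕ {n}) ≡ count f n
countFin-toℕ zero    f = refl
countFin-toℕ (suc n) f = cong (indicator (f 0) +_) (countFin-toℕ n (f ∘ suc))

indicator-mono : ∀ {b c} → (b ≡ true → c ≡ true) → indicator b ≤ indicator c
indicator-mono {false} _   = z≤n
indicator-mono {true}  b⇒c rewrite b⇒c refl = ≤-refl

countFin-mono : ∀ {n} {f g : Fin n → Bool} → f ⊆ᵇ g → countFin f ≤ countFin g
countFin-mono {zero}  f⊆g = z≤n
countFin-mono {suc n} f⊆g =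
  +-mono-≤ (indicator-mono (f⊆g Fin.zero)) (countFin-mono (f⊆g ∘ Fin.suc))

countFin-mono-< : ∀ {n} {f g : Fin n → Bool} → f ⊆ᵇ g →
  ∀ u → f u ≡ false → g u ≡ true → countFin f < countFin g
countFin-mono-< {f = f} {g} f⊆g Fin.zero fu gu rewrite fu | gu =
  s≤s (countFin-mono (f⊆g ∘ Fin.suc))
countFin-mono-< {f = f} {g} f⊆g (Fin.suc u) fu gu =
  subst (_≤ countFin g) (+-suc (indicator (f Fin.zero)) _)
    (+-mono-≤ (indicator-mono (f⊆g Fin.zero)) (countFin-mono-< (f⊆g ∘ Fin.suc) u fu gu))

countFin-saturated : ∀ {n} {f g : Fin n → Bool} → f ⊆ᵇ g → countFin g ≤ countFin f → g ⊆ᵇ f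
countFin-saturated {f = f} f⊆g g≤f u gu with f u in fu
... | true  = refl
... | false = contradiction g≤f (<⇒≱ (countFin-mono-< f⊆g u fu gu))

count-cong : ∀ {f g} l → (∀ j → j < l → f j ≡ g j) → count f l ≡ count g l
count-cong zero    f≗g = refl
count-cong (suc l) f≗g =
  cong₂ _+_ (cong indicator (f≗g 0 z<s)) (count-cong l (λ j j<l → f≗g (suc j) (s<s j<l)))

count-+ : ∀ f l₁ l₂ → count f (l₁ + l₂) ≡ count f l₁ + count (f ∘ (l₁ +_)) l₂
count-+ f zero     l₂ = refl
count-+ f (suc l₁) l₂ =
  trans (cong (indicator (f 0) +_) (count-+ (f ∘ suc) l₁ l₂)) (sym (+-assoc (indicator (f 0)) _ _))

count-snoc : ∀ f l → count f (suc l) ≡ count f l + indicator (f l)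
count-snoc f zero    = +-identityʳ _
count-snoc f (suc l) =
  trans (cong (indicator (f 0) +_) (count-snoc (f ∘ suc) l)) (sym (+-assoc (indicator (f 0)) _ _))

count-true : ∀ l → count (λ _ → true) l ≡ l
count-true zero    = refl
count-true (suc l) = cong suc (count-true l)

count-false : ∀ l → count (λ _ → false) l ≡ 0
count-false zero    = refl
count-false (suc l) = count-false l

count-<ᵇ : ∀ {b l} → b ≤ l → count (_<ᵇ b) l ≡ b
count-<ᵇ {zero}  {l}     _         = count-false l
count-<ᵇ {suc b} {suc l} (s≤s b≤l) = cong suc (count-<ᵇ b≤l)

count-not : ∀ f l → count f l + count (not ∘ f) l ≡ l
count-not f zero    = refl
count-not f (suc l) with f 0
... | true  = cong suc (count-not (f ∘ suc) l)
... | false = trans (+-suc (count (f ∘ suc) l) _) (cong suc (count-not (f ∘ suc) l))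

count-≥ : ∀ {b l} → b ≤ l → count (not ∘ (_<ᵇ b)) l ≡ l ∸ b
count-≥ {b} {l} b≤l = begin
  count ≥b l                   ≡⟨ m+n∸m≡n b _ ⟨
  b + count ≥b l ∸ b           ≡⟨ cong (λ c → c + count ≥b l ∸ b) (count-<ᵇ b≤l) ⟨
  count <b l + count ≥b l ∸ b  ≡⟨ cong (_∸ b) (count-not <b l) ⟩
  l ∸ b                        ∎
  where
  open ≡-Reasoning
  <b ≥b : ℕ → Bool
  <b = _<ᵇ b
  ≥b = not ∘ <b

count-≢ : ∀ {i l} → i < l → suc (count (λ j → not (i ≡ᵇ j)) l) ≡ l
count-≢ {zero}  {suc l} _         = cong suc (count-true l)
count-≢ {suc i} {suc l} (s≤s i<l) = cong suc (count-≢ i<l)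

remove : ℕ → (ℕ → Bool) → ℕ → Bool
remove i f j = if i ≡ᵇ j then false else f j

count-remove : ∀ f {i l} → i < l → count (remove i f) l + indicator (f i) ≡ count f l
count-remove f {zero}  {suc l} _ = +-comm (count (f ∘ suc) l) (indicator (f 0))
count-remove f {suc i} {suc l} (s≤s i<l) =
  trans (+-assoc (indicator (f 0)) _ _) (cong (indicator (f 0) +_) (count-remove (f ∘ suc) i<l))

Periodic : ℕ → (ℕ → Bool) → Set
Periodic q P = ∀ k → P (q + k) ≡ P k

count-rotate : ∀ {P} q {i} → Periodic q P → i ≤ q → count (P ∘ (i +_)) q ≡ count P q
count-rotate {P} _ {i} per i≤q with m≤n⇒∃[o]m+o≡n i≤q
... | e , refl = begin
  count (P ∘ (i +_)) (i + e)                            ≡⟨ cong (count (P ∘ (i +_))) (+-comm i e) ⟩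
  count (P ∘ (i +_)) (e + i)                            ≡⟨ count-+ (P ∘ (i +_)) e i ⟩
  count (P ∘ (i +_)) e + count (P ∘ (i +_) ∘ (e +_)) i ≡⟨ cong (count (P ∘ (i +_)) e +_) wrap ⟩
  count (P ∘ (i +_)) e + count P i                      ≡⟨ +-comm _ (count P i) ⟩
  count P i + count (P ∘ (i +_)) e                      ≡⟨ count-+ P i e ⟨
  count P (i + e)                                       ∎
  where
  open ≡-Reasoning
  wrap : count (P ∘ (i +_) ∘ (e +_)) i ≡ count P i
  wrap = count-cong i (λ k _ → trans (cong P (sym (+-assoc i e k))) (per k))

count-interleave : ∀ P l →
  count P (l + l) ≡ count (λ k → P (k + k)) l + count (λ k → P (suc (k + k))) l
count-interleave P zero    = refl
count-interleave P (suc l) = begin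
  count P (suc l + suc l)
    ≡⟨ cong (count P ∘ suc) (+-suc l l) ⟩
  p₀ + (p₁ + count (P ∘ suc ∘ suc) (l + l))
    ≡⟨ cong (λ c → p₀ + (p₁ + c)) (count-interleave (P ∘ suc ∘ suc) l) ⟩
  p₀ + (p₁ + (count evens l + count odds l))
    ≡⟨ regroup p₀ p₁ (count evens l) (count odds l) ⟩
  (p₀ + count evens l) + (p₁ + count odds l)
    ≡⟨ cong₂ _+_ (cong (p₀ +_) (shift P)) (cong (p₁ +_) (shift (P ∘ suc))) ⟩
  count (λ k → P (k + k)) (suc l) + count (λ k → P (suc (k + k))) (suc l)
    ∎
  where
  open ≡-Reasoning
  p₀ p₁ : ℕ
  p₀ = indicator (P 0)
  p₁ = indicator (P 1)
  evens odds : ℕ → Bool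
  evens k = P (suc (suc (k + k)))
  odds  k = P (suc (suc (suc (k + k))))
  shift : ∀ Q → count (λ k → Q (suc (suc (k + k)))) l ≡ count (λ k → Q (suc k + suc k)) l
  shift Q = count-cong l (λ k _ → cong (Q ∘ suc) (sym (+-suc k k)))
  regroup : ∀ a b c d → a + (b + (c + d)) ≡ (a + c) + (b + d)
  regroup = solve-∀

-- Doubling permutes the residues modulo an odd q, since 2k + 1 ≡ 2(k + (q + 1)/2) (mod q).
count-double : ∀ {P} a → Periodic (suc (a + a)) P →
  count (λ k → P (k + k)) (suc (a + a)) ≡ count P (suc (a + a))
count-double {P} a per = *-cancelˡ-≡ _ _ 2 (begin
  2 * count D q
    ≡⟨ twice (count D q) ⟩
  count D q + count D q
    ≡⟨ cong (count D q +_) (count-rotate q D-periodic (m≤m+n (suc a) a)) ⟨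
  count D q + count (D ∘ (suc a +_)) q
    ≡⟨ cong (count D q +_) (count-cong q (λ k _ → D-shift k)) ⟩
  count D q + count (λ k → P (suc (k + k))) q
    ≡⟨ count-interleave P q ⟨
  count P (q + q)
    ≡⟨ count-+ P q q ⟩
  count P q + count (P ∘ (q +_)) q
    ≡⟨ cong (count P q +_) (count-cong q (λ k _ → per k)) ⟩
  count P q + count P q
    ≡⟨ twice (count P q) ⟨
  2 * count P q
    ∎)
  where
  open ≡-Reasoning
  q : ℕ
  q = suc (a + a)
  D : ℕ → Bool
  D k = P (k + k)
  twice : ∀ c → 2 * c ≡ c + c
  twice c = cong (c +_) (+-identityʳ c)
  D-periodic : Periodic q D
  D-periodic k = trans (cong P (expand q k)) (trans (per _) (per (k + k)))
    where
    expand : ∀ q k → (q + k) + (q + k) ≡ q + (q + (k + k))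
    expand = solve-∀
  D-shift : ∀ k → D (suc a + k) ≡ P (suc (k + k))
  D-shift k = trans (cong P (expand a k)) (per (suc (k + k)))
    where
    expand : ∀ a k → (suc a + k) + (suc a + k) ≡ suc (a + a) + suc (k + k)
    expand = solve-∀

-- Round-robin regular graphs

-- The standard 1-factorisation of K_{q+1}, q odd: the edge {i, j} of Z_q gets colour i + j
-- and the edge {i, q} gets colour 2i, modulo q.
edgeColour : (q : ℕ) .{{_ : NonZero q}} → ℕ → ℕ → ℕ
edgeColour q i j =
  if i ≡ᵇ q then (j + j) % q
  else if j ≡ᵇ q then (i + i) % q
  else (i + j) % q

roundRobin : (q : ℕ) .{{_ : NonZero q}} → ℕ → ℕ → ℕ → Bool
roundRobin q r i = remove i (λ j → edgeColour q i j <ᵇ r)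

edgeColour-comm : ∀ q .{{_ : NonZero q}} i j → edgeColour q i j ≡ edgeColour q j i
edgeColour-comm q i j with i ≟ q | j ≟ q
... | yes refl | yes refl = refl
... | yes refl | no j≢q rewrite ≡ᵇ-refl i | ≡ᵇ-false j≢q = refl
... | no i≢q | yes refl rewrite ≡ᵇ-refl j | ≡ᵇ-false i≢q = refl
... | no i≢q | no j≢q rewrite ≡ᵇ-false i≢q | ≡ᵇ-false j≢q = cong (_% q) (+-comm i j)

roundRobin-sym : ∀ q .{{_ : NonZero q}} r i j → roundRobin q r i j ≡ roundRobin q r j i
roundRobin-sym q r i j with i ≟ j
... | yes refl = refl
... | no i≢j rewrite ≡ᵇ-false i≢j | ≡ᵇ-false (i≢j ∘ sym) = cong (_<ᵇ r) (edgeColour-comm q i j)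

roundRobin-irrefl : ∀ q .{{_ : NonZero q}} r i → roundRobin q r i i ≡ false
roundRobin-irrefl q r i rewrite ≡ᵇ-refl i = refl

roundRobin-mono : ∀ q .{{_ : NonZero q}} {s r} → s ≤ r → ∀ i → roundRobin q s i ⊆ᵇ roundRobin q r i
roundRobin-mono q s≤r i j with i ≡ᵇ j
... | true  = λ ()
... | false = λ below-s → <ᵇ-true (<-≤-trans (<ᵇ-true⁻¹ below-s) s≤r)

residue-periodic : ∀ q .{{_ : NonZero q}} r → Periodic q (λ t → t % q <ᵇ r)
residue-periodic q r k = cong (_<ᵇ r) (trans (cong (_% q) (+-comm q k)) ([m+n]%n≡m%n k q))

count-residue : ∀ q .{{_ : NonZero q}} {r} → r ≤ q → count (λ t → t % q <ᵇ r) q ≡ r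
count-residue q {r} r≤q = trans (count-cong q (λ t t<q → cong (_<ᵇ r) (m<n⇒m%n≡m t<q))) (count-<ᵇ r≤q)

roundRobin-degree-< : ∀ q .{{_ : NonZero q}} {r i} → r ≤ q → i < q → count (roundRobin q r i) (suc q) ≡ r
roundRobin-degree-< q {r} {i} r≤q i<q = begin
  count (roundRobin q r i) (suc q)
    ≡⟨ count-snoc (roundRobin q r i) q ⟩
  count (roundRobin q r i) q + indicator (roundRobin q r i q)
    ≡⟨ cong (λ b → count (roundRobin q r i) q + indicator b) edge-to-q ⟩
  count (roundRobin q r i) q + indicator (coloured i)
    ≡⟨ count-remove coloured i<q ⟩
  count coloured q
    ≡⟨ count-cong q (λ j j<q → cong (_<ᵇ r) (colour j (<⇒≢ j<q))) ⟩
  count (λ j → (i + j) % q <ᵇ r) q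
    ≡⟨ count-rotate q (residue-periodic q r) (<⇒≤ i<q) ⟩
  count (λ t → t % q <ᵇ r) q
    ≡⟨ count-residue q r≤q ⟩
  r ∎
  where
  open ≡-Reasoning
  coloured : ℕ → Bool
  coloured j = edgeColour q i j <ᵇ r
  colour : ∀ j → j ≢ q → edgeColour q i j ≡ (i + j) % q
  colour j j≢q rewrite ≡ᵇ-false (<⇒≢ i<q) | ≡ᵇ-false j≢q = refl
  edge-to-q : roundRobin q r i q ≡ coloured i
  edge-to-q rewrite ≡ᵇ-false (<⇒≢ i<q) | ≡ᵇ-refl q = refl

roundRobin-degree-q : ∀ a {r} → let q = suc (a + a) in r ≤ q → count (roundRobin q r q) (suc q) ≡ r
roundRobin-degree-q a {r} r≤q = begin
  count (roundRobin q r q) (suc q)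
    ≡⟨ count-snoc (roundRobin q r q) q ⟩
  count (roundRobin q r q) q + indicator (roundRobin q r q q)
    ≡⟨ cong (λ b → count (roundRobin q r q) q + indicator b) (roundRobin-irrefl q r q) ⟩
  count (roundRobin q r q) q + 0
    ≡⟨ +-identityʳ _ ⟩
  count (roundRobin q r q) q
    ≡⟨ count-cong q (λ j j<q → edge-from-q j (<⇒≢ j<q ∘ sym)) ⟩
  count (λ j → (j + j) % q <ᵇ r) q
    ≡⟨ count-double a (residue-periodic q r) ⟩
  count (λ t → t % q <ᵇ r) q
    ≡⟨ count-residue q r≤q ⟩
  r ∎
  where
  open ≡-Reasoning
  q : ℕ
  q = suc (a + a)
  edge-from-q : ∀ j → q ≢ j → roundRobin q r q j ≡ ((j + j) % q <ᵇ r)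
  edge-from-q j q≢j rewrite ≡ᵇ-false q≢j | ≡ᵇ-refl q = refl

roundRobin-regular : ∀ a {r i} → let q = suc (a + a) in
  r ≤ q → i ≤ q → count (roundRobin q r i) (suc q) ≡ r
roundRobin-regular a r≤q i≤q with m≤n⇒m<n∨m≡n i≤q
... | inj₁ i<q  = roundRobin-degree-< _ r≤q i<q
... | inj₂ refl = roundRobin-degree-q a r≤q

-- No connected s-factor

module NoConnectedFactor {n s x} (0<s : 0 < s) (2s<n : 2 * s < n)
  (G : Graph n) (G-realizes : Realizes G (seqD n s x))
  (H : Graph n) (H⊆G : H ⊆G G) (H-regular : Regular s H) where

  isA isC : Fin n → Bool
  isA w = toℕ w <ᵇ s
  isC w = not (toℕ w <ᵇ n ∸ s)

  differs : Fin n → Fin n → Bool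
  differs a w = not (toℕ a ≡ᵇ toℕ w)

  s<n∸s : s < n ∸ s
  s<n∸s = subst (_< n ∸ s) (m+n∸m≡n s s)
    (∸-monoˡ-< (subst (_< n) (cong (s +_) (+-identityʳ s)) 2s<n) (m≤m+n s s))

  s≤n∸s : s ≤ n ∸ s
  s≤n∸s = <⇒≤ s<n∸s

  s<n : s < n
  s<n = <-≤-trans s<n∸s (m∸n≤m n s)

  countFin-isA : countFin isA ≡ s
  countFin-isA = trans (countFin-toℕ n (_<ᵇ s)) (count-<ᵇ (<⇒≤ s<n))

  countFin-isC : countFin isC ≡ s
  countFin-isC = trans (countFin-toℕ n (not ∘ (_<ᵇ n ∸ s)))
    (trans (count-≥ (m∸n≤m n s)) (m∸[m∸n]≡n (<⇒≤ s<n)))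

  countFin-differs : ∀ a → countFin (differs a) ≡ n ∸ 1
  countFin-differs a =
    trans (countFin-toℕ n (λ k → not (toℕ a ≡ᵇ k))) (cong (_∸ 1) (count-≢ (toℕ<n a)))

  A-C-differ : ∀ {a c} → isA a ≡ true → isC c ≡ true → differs a c ≡ true
  A-C-differ a∈A c∈C =
    cong not (≡ᵇ-false (<⇒≢ (<-≤-trans (<ᵇ-true⁻¹ a∈A) (≤-trans s≤n∸s (not-<ᵇ-true⁻¹ c∈C)))))

  adj⊆differs : ∀ (F : Graph n) a → adj F a ⊆ᵇ differs a
  adj⊆differs F a w aw with toℕ a ≡ᵇ toℕ w in a≡ᵇw
  ... | false = refl
  ... | true  with toℕ-injective (≡ᵇ-true⁻¹ {toℕ a} {toℕ w} a≡ᵇw)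
  ...   | refl = contradiction (trans (sym (irrefl F a)) aw) λ ()

  degree-G-A : ∀ a → isA a ≡ true → countFin (adj G a) ≡ n ∸ 1
  degree-G-A a a∈A =
    trans (sym (deg≡countFin G a)) (trans (G-realizes a) (seqD-head s x a (<ᵇ-true⁻¹ a∈A)))

  degree-G-C : ∀ c → isC c ≡ true → countFin (adj G c) ≡ s
  degree-G-C c c∈C =
    trans (sym (deg≡countFin G c)) (trans (G-realizes c) (seqD-tail s x c s≤n∸s (not-<ᵇ-true⁻¹ c∈C)))

  degree-H : ∀ v → countFin (adj H v) ≡ s
  degree-H v = trans (sym (deg≡countFin H v)) (H-regular v)

  -- The next four facts are pigeonhole steps: an inclusion of vertex sets of equal size is an equality.
  A-universal : ∀ a → isA a ≡ true → differs a ⊆ᵇ adj G a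
  A-universal a a∈A =
    countFin-saturated (adj⊆differs G a) (≤-reflexive (trans (countFin-differs a) (sym (degree-G-A a a∈A))))

  G-neighbours-C⊆A : ∀ c → isC c ≡ true → adj G c ⊆ᵇ isA
  G-neighbours-C⊆A c c∈C =
    countFin-saturated A⊆adj (≤-reflexive (trans (degree-G-C c c∈C) (sym countFin-isA)))
    where
    A⊆adj : isA ⊆ᵇ adj G c
    A⊆adj w w∈A = trans (Graph.sym G c w) (A-universal w w∈A c (A-C-differ w∈A c∈C))

  A⊆H-neighbours-C : ∀ c → isC c ≡ true → isA ⊆ᵇ adj H c
  A⊆H-neighbours-C c c∈C =
    countFin-saturated adj⊆A (≤-reflexive (trans countFin-isA (sym (degree-H c))))
    where
    adj⊆A : adj H c ⊆ᵇ isA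
    adj⊆A w cw = G-neighbours-C⊆A c c∈C w (H⊆G c w cw)

  H-neighbours-A⊆C : ∀ a → isA a ≡ true → adj H a ⊆ᵇ isC
  H-neighbours-A⊆C a a∈A =
    countFin-saturated C⊆adj (≤-reflexive (trans (degree-H a) (sym countFin-isC)))
    where
    C⊆adj : isC ⊆ᵇ adj H a
    C⊆adj w w∈C = trans (Graph.sym H a w) (A⊆H-neighbours-C w w∈C a a∈A)

  Outer : Fin n → Set
  Outer w = isA w ≡ true ⊎ isC w ≡ true

  walk-preserves-Outer : ∀ {u v} → Walk H u v → Outer u → Outer v
  walk-preserves-Outer here                   out        = out
  walk-preserves-Outer (step {w = w} uw walk) (inj₁ u∈A) =
    walk-preserves-Outer walk (inj₂ (H-neighbours-A⊆C _ u∈A w uw))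
  walk-preserves-Outer (step {w = w} uw walk) (inj₂ u∈C) =
    walk-preserves-Outer walk (inj₁ (G-neighbours-C⊆A _ u∈C w (H⊆G _ w uw)))

  first middle : Fin n
  first  = fromℕ< (<-trans 0<s s<n)
  middle = fromℕ< s<n

  first∈A : isA first ≡ true
  first∈A = <ᵇ-true (subst (_< s) (sym (toℕ-fromℕ< (<-trans 0<s s<n))) 0<s)

  middle∉Outer : ¬ Outer middle
  middle∉Outer (inj₁ middle∈A) = <-irrefl (toℕ-fromℕ< s<n) (<ᵇ-true⁻¹ middle∈A)
  middle∉Outer (inj₂ middle∈C) =
    <⇒≱ s<n∸s (subst (n ∸ s ≤_) (toℕ-fromℕ< s<n) (not-<ᵇ-true⁻¹ middle∈C))

  disconnected : ¬ Connected H
  disconnected connected = middle∉Outer (walk-preserves-Outer (connected first middle) (inj₁ first∈A))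

-- A realization with an s-factor

labelled : ∀ {V : Set} {n} (E : V → V → Bool) →
  (∀ x y → E x y ≡ E y x) → (∀ x → E x x ≡ false) → (ℕ → V) → Graph n
labelled E E-sym E-irrefl f = record
  { adj    = λ u v → E (f (toℕ u)) (f (toℕ v))
  ; sym    = λ u v → E-sym (f (toℕ u)) (f (toℕ v))
  ; irrefl = λ v → E-irrefl (f (toℕ v))
  }

deg-labelled : ∀ {V : Set} {n} E E-sym E-irrefl (f : ℕ → V) (v : Fin n) →
  deg (labelled E E-sym E-irrefl f) v ≡ count (E (f (toℕ v)) ∘ f) n
deg-labelled {n = n} E E-sym E-irrefl f v =
  trans (deg≡countFin (labelled E E-sym E-irrefl f) v) (countFin-toℕ n (E (f (toℕ v)) ∘ f))

data Block : Set where
  A : ℕ → Block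
  B : ℕ → Block
  C : Block

block : ℕ → ℕ → ℕ → Block
block s m k = if k <ᵇ s then A k else if k <ᵇ s + m then B (k ∸ s) else C

block-A : ∀ s m {k} → k < s → block s m k ≡ A k
block-A s m k<s rewrite <ᵇ-true k<s = refl

block-B : ∀ s m {j} → j < m → block s m (s + j) ≡ B j
block-B s m {j} j<m
  rewrite <ᵇ-false (m≤m+n s j) | <ᵇ-true (+-monoʳ-< s j<m) | m+n∸m≡n s j = refl

block-C : ∀ s m {k} → s + m ≤ k → block s m k ≡ C
block-C s m s+m≤k rewrite <ᵇ-false (≤-trans (m≤m+n s m) s+m≤k) | <ᵇ-false s+m≤k = refl

count-blocks : ∀ s m c (F : Block → Bool) →
  count (F ∘ block s m) (s + (m + c)) ≡ count (F ∘ A) s + (count (F ∘ B) m + count (λ _ → F C) c)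
count-blocks s m c F = begin
  count f (s + (m + c))
    ≡⟨ count-+ f s (m + c) ⟩
  count f s + count (f ∘ (s +_)) (m + c)
    ≡⟨ cong (count f s +_) (count-+ (f ∘ (s +_)) m c) ⟩
  count f s + (count (f ∘ (s +_)) m + count (f ∘ (s +_) ∘ (m +_)) c)
    ≡⟨ cong₂ _+_ on-A (cong₂ _+_ on-B on-C) ⟩
  count (F ∘ A) s + (count (F ∘ B) m + count (λ _ → F C) c) ∎
  where
  open ≡-Reasoning
  f : ℕ → Bool
  f = F ∘ block s m
  on-A : count f s ≡ count (F ∘ A) s
  on-A = count-cong s (λ k k<s → cong F (block-A s m k<s))
  on-B : count (f ∘ (s +_)) m ≡ count (F ∘ B) m
  on-B = count-cong m (λ j j<m → cong F (block-B s m j<m))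
  on-C : count (f ∘ (s +_) ∘ (m +_)) c ≡ count (λ _ → F C) c
  on-C = count-cong c (λ k _ → cong F (block-C s m (s+m≤ k)))
    where
    s+m≤ : ∀ k → s + m ≤ s + (m + k)
    s+m≤ k = subst (s + m ≤_) (+-assoc s m k) (m≤m+n (s + m) k)

data Position (s m k : ℕ) : Block → Set where
  at-A : k < s → Position s m k (A k)
  at-B : ∀ {j} → j < m → k ≡ s + j → Position s m k (B j)
  at-C : s + m ≤ k → Position s m k C

position : ∀ s m k → Position s m k (block s m k)
position s m k with k <? s | k <? s + m
... | yes k<s | _         = subst (Position s m k) (sym (block-A s m k<s)) (at-A k<s)
... | no  k≮s | no  k≮s+m =
  subst (Position s m k) (sym (block-C s m (≮⇒≥ k≮s+m))) (at-C (≮⇒≥ k≮s+m))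
... | no  k≮s | yes k<s+m with m≤n⇒∃[o]m+o≡n (≮⇒≥ k≮s)
...   | j , refl = subst (Position s m (s + j)) (sym (block-B s m j<m)) (at-B j<m refl)
  where
  j<m : j < m
  j<m = +-cancelˡ-< s j m k<s+m

module Construction (s a r : ℕ) where

  q m n : ℕ
  q = suc (a + a)
  m = suc q
  n = s + (m + s)

  realisationEdge : Block → Block → Bool
  realisationEdge (A i) (A j) = not (i ≡ᵇ j)
  realisationEdge (A _) (B _) = true
  realisationEdge (A _) C     = true
  realisationEdge (B _) (A _) = true
  realisationEdge (B i) (B j) = roundRobin q r i j
  realisationEdge (B _) C     = false
  realisationEdge C     (A _) = true
  realisationEdge C     (B _) = false
  realisationEdge C     C     = false

  factorEdge : Block → Block → Bool
  factorEdge (A _) (A _) = false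
  factorEdge (A _) (B _) = false
  factorEdge (A _) C     = true
  factorEdge (B _) (A _) = false
  factorEdge (B i) (B j) = roundRobin q s i j
  factorEdge (B _) C     = false
  factorEdge C     (A _) = true
  factorEdge C     (B _) = false
  factorEdge C     C     = false

  realisationEdge-sym : ∀ x y → realisationEdge x y ≡ realisationEdge y x
  realisationEdge-sym (A i) (A j) with i ≟ j
  ... | yes refl = refl
  ... | no  i≢j  rewrite ≡ᵇ-false i≢j | ≡ᵇ-false (i≢j ∘ sym) = refl
  realisationEdge-sym (A _) (B _) = refl
  realisationEdge-sym (A _) C     = refl
  realisationEdge-sym (B _) (A _) = refl
  realisationEdge-sym (B i) (B j) = roundRobin-sym q r i j
  realisationEdge-sym (B _) C     = refl
  realisationEdge-sym C     (A _) = refl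
  realisationEdge-sym C     (B _) = refl
  realisationEdge-sym C     C     = refl

  factorEdge-sym : ∀ x y → factorEdge x y ≡ factorEdge y x
  factorEdge-sym (A _) (A _) = refl
  factorEdge-sym (A _) (B _) = refl
  factorEdge-sym (A _) C     = refl
  factorEdge-sym (B _) (A _) = refl
  factorEdge-sym (B i) (B j) = roundRobin-sym q s i j
  factorEdge-sym (B _) C     = refl
  factorEdge-sym C     (A _) = refl
  factorEdge-sym C     (B _) = refl
  factorEdge-sym C     C     = refl

  realisationEdge-irrefl : ∀ x → realisationEdge x x ≡ false
  realisationEdge-irrefl (A i) rewrite ≡ᵇ-refl i = refl
  realisationEdge-irrefl (B i) = roundRobin-irrefl q r i
  realisationEdge-irrefl C     = refl

  factorEdge-irrefl : ∀ x → factorEdge x x ≡ false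
  factorEdge-irrefl (A _) = refl
  factorEdge-irrefl (B i) = roundRobin-irrefl q s i
  factorEdge-irrefl C     = refl

  factorEdge⊆realisationEdge : s ≤ r → ∀ x → factorEdge x ⊆ᵇ realisationEdge x
  factorEdge⊆realisationEdge s≤r (A _) C     _ = refl
  factorEdge⊆realisationEdge s≤r (B i) (B j)   = roundRobin-mono q s≤r i j
  factorEdge⊆realisationEdge s≤r C     (A _) _ = refl

  realisation factor : Graph n
  realisation = labelled realisationEdge realisationEdge-sym realisationEdge-irrefl (block s m)
  factor      = labelled factorEdge factorEdge-sym factorEdge-irrefl (block s m)

  n∸s≡s+m : n ∸ s ≡ s + m
  n∸s≡s+m = trans (m+n∸m≡n s (m + s)) (+-comm m s)

  count-edges : (Block → Block → Bool) → Block → ℕ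
  count-edges E x = count (E x ∘ block s m) n

  realisation-degree-A : ∀ {i} → i < s → count-edges realisationEdge (A i) ≡ n ∸ 1
  realisation-degree-A {i} i<s = begin
    count-edges realisationEdge (A i)
      ≡⟨ count-blocks s m s (realisationEdge (A i)) ⟩
    count others s + (count (λ _ → true) m + count (λ _ → true) s)
      ≡⟨ cong (count others s +_) (cong₂ _+_ (count-true m) (count-true s)) ⟩
    count others s + (m + s)
      ≡⟨ cong (λ t → t + (m + s) ∸ 1) (count-≢ i<s) ⟩
    n ∸ 1 ∎
    where
    open ≡-Reasoning
    others : ℕ → Bool
    others j = not (i ≡ᵇ j)

  realisation-degree-B : ∀ {j} → r ≤ q → j < m → count-edges realisationEdge (B j) ≡ s + r
  realisation-degree-B {j} r≤q j<m =
    trans (count-blocks s m s (realisationEdge (B j)))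
      (cong₂ _+_ (count-true s)
        (trans (cong₂ _+_ (roundRobin-regular a r≤q (s≤s⁻¹ j<m)) (count-false s)) (+-identityʳ r)))

  realisation-degree-C : count-edges realisationEdge C ≡ s
  realisation-degree-C =
    trans (count-blocks s m s (realisationEdge C))
      (trans (cong₂ _+_ (count-true s) (cong₂ _+_ (count-false m) (count-false s))) (+-identityʳ s))

  factor-degree-A : ∀ i → count-edges factorEdge (A i) ≡ s
  factor-degree-A i =
    trans (count-blocks s m s (factorEdge (A i)))
      (cong₂ _+_ (count-false s) (cong₂ _+_ (count-false m) (count-true s)))

  factor-degree-B : ∀ {j} → s ≤ q → j < m → count-edges factorEdge (B j) ≡ s
  factor-degree-B {j} s≤q j<m =
    trans (count-blocks s m s (factorEdge (B j)))
      (cong₂ _+_ (count-false s)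
        (trans (cong₂ _+_ (roundRobin-regular a s≤q (s≤s⁻¹ j<m)) (count-false s)) (+-identityʳ s)))

  factor-degree-C : count-edges factorEdge C ≡ s
  factor-degree-C =
    trans (count-blocks s m s (factorEdge C))
      (trans (cong₂ _+_ (count-true s) (cong₂ _+_ (count-false m) (count-false s))) (+-identityʳ s))

  realisation-realizes : r ≤ q → Realizes realisation (seqD n s (s + r))
  realisation-realizes r≤q v =
    trans (deg-labelled realisationEdge realisationEdge-sym realisationEdge-irrefl (block s m) v)
      (by-position (position s m (toℕ v)))
    where
    by-position : ∀ {b} → Position s m (toℕ v) b → count-edges realisationEdge b ≡ seqD n s (s + r) v
    by-position (at-A v<s) = trans (realisation-degree-A v<s) (sym (seqD-head s (s + r) v v<s))
    by-position (at-B j<m v≡s+j) =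
      trans (realisation-degree-B r≤q j<m) (sym (seqD-middle s (s + r) v s≤v v<n∸s))
      where
      s≤v : s ≤ toℕ v
      s≤v = subst (s ≤_) (sym v≡s+j) (m≤m+n s _)
      v<n∸s : toℕ v < n ∸ s
      v<n∸s = subst₂ _<_ (sym v≡s+j) (sym n∸s≡s+m) (+-monoʳ-< s j<m)
    by-position (at-C s+m≤v) =
      trans realisation-degree-C (sym (seqD-tail s (s + r) v s≤n∸s n∸s≤v))
      where
      s≤n∸s : s ≤ n ∸ s
      s≤n∸s = subst (s ≤_) (sym n∸s≡s+m) (m≤m+n s m)
      n∸s≤v : n ∸ s ≤ toℕ v
      n∸s≤v = subst (_≤ toℕ v) (sym n∸s≡s+m) s+m≤v

  factor-regular : s ≤ q → Regular s factor
  factor-regular s≤q v =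
    trans (deg-labelled factorEdge factorEdge-sym factorEdge-irrefl (block s m) v)
      (by-position (position s m (toℕ v)))
    where
    by-position : ∀ {b} → Position s m (toℕ v) b → count-edges factorEdge b ≡ s
    by-position (at-A _)     = factor-degree-A (toℕ v)
    by-position (at-B j<m _) = factor-degree-B s≤q j<m
    by-position (at-C _)     = factor-degree-C

  factor⊆realisation : s ≤ r → factor ⊆G realisation
  factor⊆realisation s≤r u v = factorEdge⊆realisationEdge s≤r (block s m (toℕ u)) (block s m (toℕ v))

  kFactorable : s ≤ r → r ≤ q → KFactorable s (seqD n s (s + r))
  kFactorable s≤r r≤q =
      realisation , realisation-realizes r≤q
    , factor , factor⊆realisation s≤r , factor-regular (≤-trans s≤r r≤q)

kFactorable⇒graphic : ∀ {n k} {d : Fin n → ℕ} → KFactorable k d → Graphic d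
kFactorable⇒graphic (G , G-realizes , _) = G , G-realizes

noConnectedKFactor : ∀ {n s} x → 0 < s → 2 * s < n → NoConnectedKFactor s (seqD n s x)
noConnectedKFactor x 0<s 2s<n G G-realizes H (H⊆G , H-regular) =
  NoConnectedFactor.disconnected 0<s 2s<n G G-realizes H H⊆G H-regular

even-shape : ∀ {n s} → 2 ∣ n → 2 * s < n → Σ ℕ λ a → n ≡ s + (suc (suc (a + a)) + s)
even-shape {n} {s} (divides N n≡N*2) 2s<n with m≤n⇒∃[o]m+o≡n s<N
  where
  s<N : s < N
  s<N = *-cancelˡ-< 2 s N (subst (2 * s <_) (trans n≡N*2 (*-comm N 2)) 2s<n)
... | a , s+1+a≡N = a , trans n≡N*2 (trans (cong (_* 2) (sym s+1+a≡N)) (expand s a))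
  where
  expand : ∀ s a → (suc s + a) * 2 ≡ s + (suc (suc (a + a)) + s)
  expand = solve-∀

inner-degree-bounds : ∀ s a r → 2 * s ≤ s + r → s + r + s + 1 ≤ s + (suc (suc (a + a)) + s) →
  s ≤ r × r ≤ suc (a + a)
inner-degree-bounds s a r 2s≤s+r upper =
    +-cancelˡ-≤ s s r (subst (_≤ s + r) (cong (s +_) (+-identityʳ s)) 2s≤s+r)
  , s≤s⁻¹ (+-cancelʳ-≤ s (suc r) _ (+-cancelˡ-≤ s _ _ (subst (_≤ n) (rearrange s r) upper)))
  where
  n : ℕ
  n = s + (suc (suc (a + a)) + s)
  rearrange : ∀ s r → s + r + s + 1 ≡ s + (suc r + s)
  rearrange = solve-∀

claim2 : (n s x : ℕ) → 2 ∣ n → 1 ≤ s → 2 * s < n →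
    2 * s ≤ x → x + s + 1 ≤ n →
    Graphic (seqD n s x) × KFactorable s (seqD n s x)
      × NoConnectedKFactor s (seqD n s x)
claim2 n s x 2∣n 1≤s 2s<n 2s≤x x+s+1≤n
  with even-shape {n} {s} 2∣n 2s<n | m≤n⇒∃[o]m+o≡n (≤-trans (m≤n*m s 2) 2s≤x)
... | a , refl | r , refl =
  kFactorable⇒graphic factorable , factorable , noConnectedKFactor (s + r) 1≤s 2s<n
  where
  factorable : KFactorable s (seqD (s + (suc (suc (a + a)) + s)) s (s + r))
  factorable = uncurry (Construction.kFactorable s a r) (inner-degree-bounds s a r 2s≤x x+s+1≤n)
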